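{- For nonnegative integers $a\ge d\ge b\ge c$, $$\sum_s{a-b\brack b-s}_q{b-c\brack s-c}_q{a-2b+s\brack d-2b+s}_q\,q^{(b-s)^2}={a-b\brack d-b}_q{d-c\brack b-c}_q,$$ where the sum is over all integers $s$.
   Context: ${n\brack k}_q$ denotes the Gaussian ($q$-)binomial coefficient, with the convention that it is $0$ whenever $n$ or $k$ is negative or $k\notin[0,n]$. -}

module Defs where

open import Level using (Level)
open import Algebra.Bundles using (CommutativeRing)
open import Data.Nat using (ℕ; zero; suc)
open import Data.Integer using (ℤ; +_; -[1+_])

-- Gaussian binomial coefficients, evaluated at an element q of an
-- arbitrary commutative ring R (taking R = ℤ[q] recovers the polynomials).
module Gauss {c ℓ : Level} (R : CommutativeRing c ℓ) (q : CommutativeRing.Carrier R) where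
  open CommutativeRing R hiding (zero)

  qpow : ℕ → Carrier
  qpow zero    = 1#
  qpow (suc n) = q * qpow n

  gauss : ℕ → ℕ → Carrier
  gauss n       zero    = 1#
  gauss zero    (suc k) = 0#
  gauss (suc n) (suc k) = gauss n k + qpow (suc k) * gauss n (suc k)

  gaussℤ : ℤ → ℤ → Carrier
  gaussℤ (+ n)      (+ k)      = gauss n k
  gaussℤ (+ n)      -[1+ _ ]   = 0#
  gaussℤ -[1+ _ ]   _          = 0#

  sumTo : (ℕ → Carrier) → ℕ → Carrier
  sumTo f zero    = f zero
  sumTo f (suc n) = sumTo f n + f (suc n)

-- Write b = c + m, d = b + e and a = d + x.  Only s = c + k with 0 ≤ k ≤ m contributes,
-- and with t = b − s = m − k the summand is [e+x, t] [m, k] [e+x−t, e−t] q^(t²), which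
-- vanishes unless t ≤ e.  For t ≤ e the trinomial revision
-- [e+x, t] [e+x−t, e−t] = [e+x, e] [e, t] pulls out the constant factor [e+x, e], and
-- what remains, Σ_k [m, k] [e, m−k] q^((m−k)²), is the q-Vandermonde convolution [m+e, m].
module Submission where

open import Defs
open import Level using (Level)
open import Algebra.Bundles using (CommutativeRing)
open import Data.Nat using (ℕ; _≤_)
open import Data.Integer using (ℤ; +_; ∣_∣) renaming (_-_ to _-ℤ_; _+_ to _+ℤ_)
open import Data.Nat using () renaming (_*_ to _*ℕ_)

open import Data.Nat using (zero; suc; _∸_; _<_; z≤n; s≤s; _<?_; _≤?_) renaming (_+_ to _+ℕ_)
import Data.Nat.Properties as ℕₚ
open ℕₚ using (m+n∸m≡n; m+[n∸m]≡n; +-∸-assoc; ≤-refl; m≤m+n; m≤n⇒m≤1+n; n<1+n; ≮⇒≥; ≰⇒>;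
               m≤n⇒∃[o]m+o≡n)
open import Data.Integer using (-[1+_]; -_)
open import Data.Integer.Properties using (m-n≡m⊖n; ⊖-≥; ⊖-<)
open import Data.Product using (_,_; proj₂)
open import Relation.Binary.PropositionalEquality as ≡ using (_≡_; cong; cong₂; module ≡-Reasoning)
open import Relation.Nullary using (yes; no)

m+n≡o⇒o-m≡n : ∀ m n {o} → m +ℕ n ≡ o → + o -ℤ + m ≡ + n
m+n≡o⇒o-m≡n m n ≡.refl =
  ≡.trans (m-n≡m⊖n (m +ℕ n) m) (≡.trans (⊖-≥ (m≤m+n m n)) (cong +_ (m+n∸m≡n m n)))

m+1+n≡o⇒m-o≡-[1+n] : ∀ {m n o} → suc m +ℕ n ≡ o → + m -ℤ + o ≡ -[1+ n ]
m+1+n≡o⇒m-o≡-[1+n] {m} {n} ≡.refl =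
  ≡.trans (m-n≡m⊖n m (suc m +ℕ n))
    (≡.trans (⊖-< (s≤s (m≤m+n m n))) (cong (λ k → - (+ k)) m+1+n∸m≡1+n))
  where
    m+1+n∸m≡1+n : suc m +ℕ n ∸ m ≡ suc n
    m+1+n∸m≡1+n = ≡.trans (cong (_∸ m) (≡.sym (ℕₚ.+-suc m n))) (m+n∸m≡n m (suc n))

module _ where
  open import Data.Integer.Tactic.RingSolver
  open Data.Integer using (_+_; _-_)

  [a-[b+b]]+s≡[a-b]-[b-s] : ∀ a b s → (a - (b + b)) + s ≡ (a - b) - (b - s)
  [a-[b+b]]+s≡[a-b]-[b-s] = solve-∀

vandermonde-exponent : ∀ {m} j r → j < m → j ≤ r →
  suc j +ℕ (m ∸ j) *ℕ (r ∸ j) ≡ suc r +ℕ (m ∸ suc j) *ℕ (r ∸ j)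
vandermonde-exponent {suc m} j r (s≤s j≤m) j≤r = begin
  suc j +ℕ (suc m ∸ j) *ℕ (r ∸ j)
    ≡⟨ cong (λ k → suc j +ℕ k *ℕ (r ∸ j)) (+-∸-assoc 1 j≤m) ⟩
  suc j +ℕ ((r ∸ j) +ℕ (m ∸ j) *ℕ (r ∸ j))
    ≡⟨ ≡.sym (ℕₚ.+-assoc (suc j) (r ∸ j) _) ⟩
  suc (j +ℕ (r ∸ j)) +ℕ (m ∸ j) *ℕ (r ∸ j)
    ≡⟨ cong (λ k → suc k +ℕ (m ∸ j) *ℕ (r ∸ j)) (m+[n∸m]≡n j≤r) ⟩
  suc r +ℕ (m ∸ j) *ℕ (r ∸ j) ∎
  where open ≡-Reasoning

module GaussianIdentities {r ℓ : Level} (R : CommutativeRing r ℓ) (q : CommutativeRing.Carrier R) where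
  open CommutativeRing R hiding (zero)
  open Gauss R q
  open import Algebra.Solver.Ring.NaturalCoefficients.Default commutativeSemiring
  open import Relation.Binary.Reasoning.Setoid setoid

  x≈0⇒x*y≈0 : ∀ {x} y → x ≈ 0# → x * y ≈ 0#
  x≈0⇒x*y≈0 y x≈0 = trans (*-congʳ x≈0) (zeroˡ y)

  y≈0⇒x*y≈0 : ∀ x {y} → y ≈ 0# → x * y ≈ 0#
  y≈0⇒x*y≈0 x y≈0 = trans (*-congˡ y≈0) (zeroʳ x)

  qpow-+ : ∀ m n → qpow (m +ℕ n) ≈ qpow m * qpow n
  qpow-+ zero    n = sym (*-identityˡ _)
  qpow-+ (suc m) n = trans (*-congˡ (qpow-+ m n)) (sym (*-assoc _ _ _))

  n<k⇒gauss≈0 : ∀ {n k} → n < k → gauss n k ≈ 0#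
  n<k⇒gauss≈0 {zero}  {suc k} _         = refl
  n<k⇒gauss≈0 {suc n} {suc k} (s≤s n<k) =
    trans (+-cong (n<k⇒gauss≈0 n<k) (y≈0⇒x*y≈0 _ (n<k⇒gauss≈0 (m≤n⇒m≤1+n n<k))))
          (+-identityʳ 0#)

  gauss-diagonal : ∀ n → gauss n n ≈ 1#
  gauss-diagonal zero    = refl
  gauss-diagonal (suc n) =
    trans (+-cong (gauss-diagonal n) (y≈0⇒x*y≈0 _ (n<k⇒gauss≈0 (n<1+n n)))) (+-identityʳ 1#)

  gaussℤ-negative : ∀ x n → gaussℤ x -[1+ n ] ≈ 0#
  gaussℤ-negative (+ _)    _ = refl
  gaussℤ-negative -[1+ _ ] _ = refl

  m<n⇒gaussℤ[m-n]≈0 : ∀ x {m n} → m < n → gaussℤ x (+ m -ℤ + n) ≈ 0#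
  m<n⇒gaussℤ[m-n]≈0 x m<n with o , 1+m+o≡n ← m≤n⇒∃[o]m+o≡n m<n =
    trans (reflexive (cong (gaussℤ x) (m+1+n≡o⇒m-o≡-[1+n] 1+m+o≡n))) (gaussℤ-negative x o)

  sumTo-cong : ∀ {f g} n → (∀ k → k ≤ n → f k ≈ g k) → sumTo f n ≈ sumTo g n
  sumTo-cong zero    f≈g = f≈g 0 ≤-refl
  sumTo-cong (suc n) f≈g =
    +-cong (sumTo-cong n (λ k k≤n → f≈g k (m≤n⇒m≤1+n k≤n))) (f≈g (suc n) ≤-refl)

  sumTo-+ : ∀ f g n → sumTo (λ k → f k + g k) n ≈ sumTo f n + sumTo g n
  sumTo-+ f g zero    = refl
  sumTo-+ f g (suc n) = trans (+-congʳ (sumTo-+ f g n))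
    (solve 4 (λ a b c d → (a :+ b) :+ (c :+ d) := (a :+ c) :+ (b :+ d)) refl _ _ _ _)

  *-sumTo : ∀ x f n → x * sumTo f n ≈ sumTo (λ k → x * f k) n
  *-sumTo x f zero    = refl
  *-sumTo x f (suc n) = trans (distribˡ x _ _) (+-congʳ (*-sumTo x f n))

  sumTo-suc : ∀ f n → sumTo f (suc n) ≈ f 0 + sumTo (λ k → f (suc k)) n
  sumTo-suc f zero    = refl
  sumTo-suc f (suc n) = trans (+-congʳ (sumTo-suc f n)) (+-assoc _ _ _)

  sumTo-dropTail : ∀ f m j → (∀ i → m < i → f i ≈ 0#) → sumTo f (m +ℕ j) ≈ sumTo f m
  sumTo-dropTail f m zero    _        = reflexive (cong (sumTo f) (ℕₚ.+-identityʳ m))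
  sumTo-dropTail f m (suc j) tail≈0 = begin
    sumTo f (m +ℕ suc j)                 ≡⟨ cong (sumTo f) (ℕₚ.+-suc m j) ⟩
    sumTo f (m +ℕ j) + f (suc (m +ℕ j))  ≈⟨ +-cong (sumTo-dropTail f m j tail≈0) (tail≈0 _ (s≤s (m≤m+n m j))) ⟩
    sumTo f m + 0#                       ≈⟨ +-identityʳ _ ⟩
    sumTo f m                            ∎

  sumTo-dropHead : ∀ f m j → (∀ i → i < m → f i ≈ 0#) →
    sumTo f (m +ℕ j) ≈ sumTo (λ k → f (m +ℕ k)) j
  sumTo-dropHead f zero    j _      = refl
  sumTo-dropHead f (suc m) j head≈0 = begin
    sumTo f (suc m +ℕ j)                    ≈⟨ sumTo-suc f (m +ℕ j) ⟩
    f 0 + sumTo (λ k → f (suc k)) (m +ℕ j)  ≈⟨ +-cong (head≈0 0 (s≤s z≤n)) (sumTo-dropHead (λ k → f (suc k)) m j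
                                                 (λ i i<m → head≈0 (suc i) (s≤s i<m))) ⟩
    0# + sumTo (λ k → f (suc m +ℕ k)) j     ≈⟨ +-identityˡ _ ⟩
    sumTo (λ k → f (suc m +ℕ k)) j          ∎

  trinomialˡ : ℕ → ℕ → ℕ → Carrier
  trinomialˡ t k r = gauss (t +ℕ k +ℕ r) t * gauss (k +ℕ r) k

  trinomialʳ : ℕ → ℕ → ℕ → Carrier
  trinomialʳ t k r = gauss (t +ℕ k +ℕ r) (t +ℕ k) * gauss (t +ℕ k) t

  cornerˡ : ℕ → ℕ → ℕ → Carrier
  cornerˡ t k r = gauss (t +ℕ suc k +ℕ r) (suc t) * gauss (k +ℕ r) (suc k)

  cornerʳ : ℕ → ℕ → ℕ → Carrier
  cornerʳ t k r =
    gauss (t +ℕ suc k +ℕ r) (suc (t +ℕ suc k)) * gauss (suc (t +ℕ suc k)) (suc t)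

  trinomialˡ-step : ∀ t k r → trinomialˡ (suc t) (suc k) r
    ≈ trinomialˡ t (suc k) r + qpow (suc t) * (trinomialˡ (suc t) k r + qpow (suc k) * cornerˡ t k r)
  trinomialˡ-step t k r = begin
    (g₁ + qpow (suc t) * g₂) * (h₁ + qpow (suc k) * h₂)
      ≈⟨ solve 6 (λ g₁ g₂ h₁ h₂ qt qk → (g₁ :+ qt :* g₂) :* (h₁ :+ qk :* h₂)
                    := g₁ :* (h₁ :+ qk :* h₂) :+ qt :* (g₂ :* h₁ :+ qk :* (g₂ :* h₂)))
                 refl g₁ g₂ h₁ h₂ (qpow (suc t)) (qpow (suc k)) ⟩
    g₁ * (h₁ + qpow (suc k) * h₂) + qpow (suc t) * (g₂ * h₁ + qpow (suc k) * (g₂ * h₂))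
      ≡⟨ cong (λ n → g₁ * (h₁ + qpow (suc k) * h₂)
                       + qpow (suc t) * (gauss (n +ℕ r) (suc t) * h₁ + qpow (suc k) * (g₂ * h₂)))
              (ℕₚ.+-suc t k) ⟩
    trinomialˡ t (suc k) r + qpow (suc t) * (trinomialˡ (suc t) k r + qpow (suc k) * cornerˡ t k r) ∎
    where
      g₁ g₂ h₁ h₂ : Carrier
      g₁ = gauss (t +ℕ suc k +ℕ r) t
      g₂ = gauss (t +ℕ suc k +ℕ r) (suc t)
      h₁ = gauss (k +ℕ r) k
      h₂ = gauss (k +ℕ r) (suc k)

  trinomialʳ-step : ∀ t k r → trinomialʳ (suc t) (suc k) r
    ≈ trinomialʳ t (suc k) r + qpow (suc t) * (trinomialʳ (suc t) k r + qpow (suc k) * cornerʳ t k r)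
  trinomialʳ-step t k r = begin
    (g₁ + qpow (suc t +ℕ suc k) * g₂) * (h₁ + qpow (suc t) * h₂)
      ≈⟨ *-congʳ (+-congˡ (*-congʳ (qpow-+ (suc t) (suc k)))) ⟩
    (g₁ + qpow (suc t) * qpow (suc k) * g₂) * (h₁ + qpow (suc t) * h₂)
      ≈⟨ solve 6 (λ g₁ g₂ h₁ h₂ qt qk → (g₁ :+ qt :* qk :* g₂) :* (h₁ :+ qt :* h₂)
                    := g₁ :* h₁ :+ qt :* (g₁ :* h₂ :+ qk :* (g₂ :* (h₁ :+ qt :* h₂))))
                 refl g₁ g₂ h₁ h₂ (qpow (suc t)) (qpow (suc k)) ⟩
    g₁ * h₁ + qpow (suc t) * (g₁ * h₂ + qpow (suc k) * (g₂ * (h₁ + qpow (suc t) * h₂)))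
      ≡⟨ cong (λ n → g₁ * h₁
                       + qpow (suc t) * (gauss (n +ℕ r) n * gauss n (suc t) + qpow (suc k) * cornerʳ t k r))
              (ℕₚ.+-suc t k) ⟩
    trinomialʳ t (suc k) r + qpow (suc t) * (trinomialʳ (suc t) k r + qpow (suc k) * cornerʳ t k r) ∎
    where
      g₁ g₂ h₁ h₂ : Carrier
      g₁ = gauss (t +ℕ suc k +ℕ r) (t +ℕ suc k)
      g₂ = gauss (t +ℕ suc k +ℕ r) (suc (t +ℕ suc k))
      h₁ = gauss (t +ℕ suc k) t
      h₂ = gauss (t +ℕ suc k) (suc t)

  -- Both sides satisfy the same recurrence in (t, k) by the q-Pascal rule; the remaining
  -- corner terms are the identity itself at r − 1, and vanish for r = 0.
  mutual
    trinomial : ∀ t k r → trinomialˡ t k r ≈ trinomialʳ t k r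
    trinomial zero    k       r = trans (*-identityˡ _) (sym (*-identityʳ _))
    trinomial (suc t) zero    r = begin
      gauss (suc t +ℕ 0 +ℕ r) (suc t) * 1#       ≈⟨ *-identityʳ _ ⟩
      gauss (suc t +ℕ 0 +ℕ r) (suc t)            ≡⟨ cong (gauss (suc t +ℕ 0 +ℕ r)) (≡.sym (ℕₚ.+-identityʳ (suc t))) ⟩
      gauss (suc t +ℕ 0 +ℕ r) (suc t +ℕ 0)       ≈⟨ sym (*-identityʳ _) ⟩
      gauss (suc t +ℕ 0 +ℕ r) (suc t +ℕ 0) * 1#  ≈⟨ *-congˡ (sym diagonal) ⟩
      trinomialʳ (suc t) 0 r                     ∎
      where
        diagonal : gauss (suc t +ℕ 0) (suc t) ≈ 1#
        diagonal = trans (reflexive (cong (λ n → gauss n (suc t)) (ℕₚ.+-identityʳ (suc t))))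
                         (gauss-diagonal (suc t))
    trinomial (suc t) (suc k) r = begin
      trinomialˡ (suc t) (suc k) r
        ≈⟨ trinomialˡ-step t k r ⟩
      trinomialˡ t (suc k) r + qpow (suc t) * (trinomialˡ (suc t) k r + qpow (suc k) * cornerˡ t k r)
        ≈⟨ +-cong (trinomial t (suc k) r)
                  (*-congˡ (+-cong (trinomial (suc t) k r) (*-congˡ (corner t k r)))) ⟩
      trinomialʳ t (suc k) r + qpow (suc t) * (trinomialʳ (suc t) k r + qpow (suc k) * cornerʳ t k r)
        ≈⟨ sym (trinomialʳ-step t k r) ⟩
      trinomialʳ (suc t) (suc k) r ∎

    corner : ∀ t k r → cornerˡ t k r ≈ cornerʳ t k r
    corner t k zero    =
      trans (y≈0⇒x*y≈0 _ (n<k⇒gauss≈0 (s≤s (ℕₚ.≤-reflexive (ℕₚ.+-identityʳ k)))))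
            (sym (x≈0⇒x*y≈0 _ (n<k⇒gauss≈0 (s≤s (ℕₚ.≤-reflexive (ℕₚ.+-identityʳ (t +ℕ suc k)))))))
    corner t k (suc r) = begin
      gauss (t +ℕ suc k +ℕ suc r) (suc t) * gauss (k +ℕ suc r) (suc k)
        ≡⟨ cong₂ (λ n l → gauss n (suc t) * gauss l (suc k)) (ℕₚ.+-suc (t +ℕ suc k) r) (ℕₚ.+-suc k r) ⟩
      trinomialˡ (suc t) (suc k) r
        ≈⟨ trinomial (suc t) (suc k) r ⟩
      trinomialʳ (suc t) (suc k) r
        ≡⟨ cong (λ n → gauss n (suc (t +ℕ suc k)) * gauss (suc (t +ℕ suc k)) (suc t))
                (≡.sym (ℕₚ.+-suc (t +ℕ suc k) r)) ⟩
      cornerʳ t k (suc r) ∎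

  -- The term of Σ_{k ≤ r} [m, k] [n, r−k] q^((m−k)(r−k)); the truncated m ∸ k is wrong
  -- only for k > m, where [m, k] = 0.
  vandermondeTerm : ℕ → ℕ → ℕ → ℕ → Carrier
  vandermondeTerm m n r k = gauss m k * gauss n (r ∸ k) * qpow ((m ∸ k) *ℕ (r ∸ k))

  vandermondeTerm-suc-zero : ∀ m n r →
    vandermondeTerm (suc m) n (suc r) 0 ≈ qpow (suc r) * vandermondeTerm m n (suc r) 0
  vandermondeTerm-suc-zero m n r = begin
    1# * gauss n (suc r) * qpow (suc r +ℕ m *ℕ suc r)
      ≈⟨ *-congˡ (qpow-+ (suc r) (m *ℕ suc r)) ⟩
    1# * gauss n (suc r) * (qpow (suc r) * qpow (m *ℕ suc r))
      ≈⟨ solve 4 (λ a b c d → a :* b :* (c :* d) := c :* (a :* b :* d)) refl _ _ _ _ ⟩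
    qpow (suc r) * (1# * gauss n (suc r) * qpow (m *ℕ suc r)) ∎

  vandermondeTerm-suc-suc : ∀ m n r j → j ≤ r → vandermondeTerm (suc m) n (suc r) (suc j)
    ≈ vandermondeTerm m n r j + qpow (suc r) * vandermondeTerm m n (suc r) (suc j)
  vandermondeTerm-suc-suc m n r j j≤r = begin
    (gauss m j + qpow (suc j) * gauss m (suc j)) * g * qpow e
      ≈⟨ solve 5 (λ a b c g x → (a :+ b :* c) :* g :* x := a :* g :* x :+ (c :* (b :* x)) :* g)
                 refl _ _ _ _ _ ⟩
    gauss m j * g * qpow e + gauss m (suc j) * (qpow (suc j) * qpow e) * g
      ≈⟨ +-congˡ (*-congʳ (*-congˡ (sym (qpow-+ (suc j) e)))) ⟩
    vandermondeTerm m n r j + gauss m (suc j) * qpow (suc j +ℕ e) * g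
      ≈⟨ +-congˡ (*-congʳ shifted-weight) ⟩
    vandermondeTerm m n r j + gauss m (suc j) * qpow (suc r +ℕ e′) * g
      ≈⟨ +-congˡ (*-congʳ (*-congˡ (qpow-+ (suc r) e′))) ⟩
    vandermondeTerm m n r j + gauss m (suc j) * (qpow (suc r) * qpow e′) * g
      ≈⟨ +-congˡ (solve 4 (λ a b c g → a :* (b :* c) :* g := b :* (a :* g :* c)) refl _ _ _ _) ⟩
    vandermondeTerm m n r j + qpow (suc r) * vandermondeTerm m n (suc r) (suc j) ∎
    where
      g : Carrier
      g = gauss n (r ∸ j)
      e e′ : ℕ
      e  = (m ∸ j) *ℕ (r ∸ j)
      e′ = (m ∸ suc j) *ℕ (r ∸ j)
      shifted-weight : gauss m (suc j) * qpow (suc j +ℕ e) ≈ gauss m (suc j) * qpow (suc r +ℕ e′)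
      shifted-weight with j <? m
      ... | yes j<m = *-congˡ (reflexive (cong qpow (vandermonde-exponent j r j<m j≤r)))
      ... | no  j≮m = trans (x≈0⇒x*y≈0 _ [m,1+j]≈0) (sym (x≈0⇒x*y≈0 _ [m,1+j]≈0))
        where
          [m,1+j]≈0 : gauss m (suc j) ≈ 0#
          [m,1+j]≈0 = n<k⇒gauss≈0 (s≤s (≮⇒≥ j≮m))

  q-vandermonde : ∀ m n r → sumTo (vandermondeTerm m n r) r ≈ gauss (m +ℕ n) r
  q-vandermonde zero    n r = begin
    sumTo (vandermondeTerm 0 n r) r
      ≈⟨ sumTo-dropTail (vandermondeTerm 0 n r) 0 r (λ { (suc i) _ → x≈0⇒x*y≈0 _ (zeroˡ _) }) ⟩
    1# * gauss n r * 1#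
      ≈⟨ trans (*-identityʳ _) (*-identityˡ _) ⟩
    gauss n r ∎
  q-vandermonde (suc m) n zero    =
    trans (*-congˡ (reflexive (cong qpow (ℕₚ.*-zeroʳ (suc m))))) (trans (*-identityʳ _) (*-identityʳ 1#))
  q-vandermonde (suc m) n (suc r) = begin
    sumTo (vandermondeTerm (suc m) n (suc r)) (suc r)
      ≈⟨ sumTo-suc (vandermondeTerm (suc m) n (suc r)) r ⟩
    vandermondeTerm (suc m) n (suc r) 0 + sumTo (λ j → vandermondeTerm (suc m) n (suc r) (suc j)) r
      ≈⟨ +-cong (vandermondeTerm-suc-zero m n r) (sumTo-cong r (vandermondeTerm-suc-suc m n r)) ⟩
    qpow (suc r) * W 0 + sumTo (λ j → vandermondeTerm m n r j + qpow (suc r) * W (suc j)) r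
      ≈⟨ +-congˡ (trans (sumTo-+ (vandermondeTerm m n r) _ r)
                        (+-congˡ (sym (*-sumTo (qpow (suc r)) (λ j → W (suc j)) r)))) ⟩
    qpow (suc r) * W 0 + (sumTo (vandermondeTerm m n r) r + qpow (suc r) * sumTo (λ j → W (suc j)) r)
      ≈⟨ solve 4 (λ a b c d → a :* b :+ (c :+ a :* d) := c :+ a :* (b :+ d)) refl _ _ _ _ ⟩
    sumTo (vandermondeTerm m n r) r + qpow (suc r) * (W 0 + sumTo (λ j → W (suc j)) r)
      ≈⟨ +-cong (q-vandermonde m n r) (*-congˡ (trans (sym (sumTo-suc W r)) (q-vandermonde m n (suc r)))) ⟩
    gauss (suc m +ℕ n) (suc r) ∎
    where
      W : ℕ → Carrier
      W = vandermondeTerm m n (suc r)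

  summand : ℤ → ℤ → ℤ → ℤ → ℕ → Carrier
  summand A B C D s = gaussℤ (A -ℤ B) (B -ℤ + s) * gaussℤ (B -ℤ C) (+ s -ℤ C)
                        * gaussℤ ((A -ℤ (B +ℤ B)) +ℤ + s) ((D -ℤ (B +ℤ B)) +ℤ + s)
                        * qpow (∣ B -ℤ + s ∣ *ℕ ∣ B -ℤ + s ∣)

  summand-vanishes-above : ∀ A b C D {s} → b < s → summand A (+ b) C D s ≈ 0#
  summand-vanishes-above A b C D b<s =
    x≈0⇒x*y≈0 _ (x≈0⇒x*y≈0 _ (x≈0⇒x*y≈0 _ (m<n⇒gaussℤ[m-n]≈0 (A -ℤ + b) b<s)))

  summand-vanishes-below : ∀ A B c D {s} → s < c → summand A B (+ c) D s ≈ 0#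
  summand-vanishes-below A B c D s<c =
    x≈0⇒x*y≈0 _ (x≈0⇒x*y≈0 _ (y≈0⇒x*y≈0 _ (m<n⇒gaussℤ[m-n]≈0 (B -ℤ + c) s<c)))

  offsetSummand : ℤ → ℤ → ℤ → ℤ → ℤ → Carrier
  offsetSummand P E M K U =
    gaussℤ P U * gaussℤ M K * gaussℤ (P -ℤ U) (E -ℤ U) * qpow (∣ U ∣ *ℕ ∣ U ∣)

  summand≡offsetSummand : ∀ A B C D s →
    summand A B C D s ≡ offsetSummand (A -ℤ B) (D -ℤ B) (B -ℤ C) (+ s -ℤ C) (B -ℤ + s)
  summand≡offsetSummand A B C D s =
    cong₂ (λ n k → gaussℤ (A -ℤ B) (B -ℤ + s) * gaussℤ (B -ℤ C) (+ s -ℤ C) * gaussℤ n k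
                     * qpow (∣ B -ℤ + s ∣ *ℕ ∣ B -ℤ + s ∣))
          ([a-[b+b]]+s≡[a-b]-[b-s] A B (+ s)) ([a-[b+b]]+s≡[a-b]-[b-s] D B (+ s))

  offsetSummand-cong : ∀ {P P′ E E′ M M′ K K′ U U′} →
    P ≡ P′ → E ≡ E′ → M ≡ M′ → K ≡ K′ → U ≡ U′ → offsetSummand P E M K U ≡ offsetSummand P′ E′ M′ K′ U′
  offsetSummand-cong ≡.refl ≡.refl ≡.refl ≡.refl ≡.refl = ≡.refl

  offsetSummand-factorises : ∀ e x k t → offsetSummand (+ (e +ℕ x)) (+ e) (+ (k +ℕ t)) (+ k) (+ t)
    ≈ gauss (e +ℕ x) e * (gauss (k +ℕ t) k * gauss e t * qpow (t *ℕ t))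
  offsetSummand-factorises e x k t with t ≤? e
  ... | no t≰e =
    trans (x≈0⇒x*y≈0 _ (y≈0⇒x*y≈0 _ (m<n⇒gaussℤ[m-n]≈0 (+ (e +ℕ x) -ℤ + t) (≰⇒> t≰e))))
          (sym (y≈0⇒x*y≈0 _ (x≈0⇒x*y≈0 _ (y≈0⇒x*y≈0 _ (n<k⇒gauss≈0 (≰⇒> t≰e))))))
  ... | yes t≤e with y , ≡.refl ← m≤n⇒∃[o]m+o≡n t≤e = begin
    gauss (t +ℕ y +ℕ x) t * gauss (k +ℕ t) k * gaussℤ (+ (t +ℕ y +ℕ x) -ℤ + t) (+ (t +ℕ y) -ℤ + t)
      * qpow (t *ℕ t)
      ≡⟨ cong₂ (λ n l → gauss (t +ℕ y +ℕ x) t * gauss (k +ℕ t) k * gaussℤ n l * qpow (t *ℕ t))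
               (m+n≡o⇒o-m≡n t (y +ℕ x) (≡.sym (ℕₚ.+-assoc t y x))) (m+n≡o⇒o-m≡n t y ≡.refl) ⟩
    gauss (t +ℕ y +ℕ x) t * gauss (k +ℕ t) k * gauss (y +ℕ x) y * qpow (t *ℕ t)
      ≈⟨ solve 4 (λ a b c d → a :* b :* c :* d := (a :* c) :* (b :* d)) refl _ _ _ _ ⟩
    trinomialˡ t y x * (gauss (k +ℕ t) k * qpow (t *ℕ t))
      ≈⟨ *-congʳ (trinomial t y x) ⟩
    trinomialʳ t y x * (gauss (k +ℕ t) k * qpow (t *ℕ t))
      ≈⟨ solve 4 (λ a b c d → (a :* b) :* (c :* d) := a :* (c :* b :* d)) refl _ _ _ _ ⟩
    gauss (t +ℕ y +ℕ x) (t +ℕ y) * (gauss (k +ℕ t) k * gauss (t +ℕ y) t * qpow (t *ℕ t)) ∎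

  vandermondeTerm-diagonal : ∀ k t n →
    vandermondeTerm (k +ℕ t) n (k +ℕ t) k ≡ gauss (k +ℕ t) k * gauss n t * qpow (t *ℕ t)
  vandermondeTerm-diagonal k t n =
    cong (λ u → gauss (k +ℕ t) k * gauss n u * qpow (u *ℕ u)) (m+n∸m≡n k t)

  summand-at-c+k : ∀ c m e x k → k ≤ m →
    summand (+ (c +ℕ m +ℕ e +ℕ x)) (+ (c +ℕ m)) (+ c) (+ (c +ℕ m +ℕ e)) (c +ℕ k)
      ≈ gauss (e +ℕ x) e * vandermondeTerm m e m k
  summand-at-c+k c m e x k k≤m with t , ≡.refl ← m≤n⇒∃[o]m+o≡n k≤m = begin
    summand (+ (b +ℕ e +ℕ x)) (+ b) (+ c) (+ (b +ℕ e)) (c +ℕ k)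
      ≡⟨ summand≡offsetSummand (+ (b +ℕ e +ℕ x)) (+ b) (+ c) (+ (b +ℕ e)) (c +ℕ k) ⟩
    offsetSummand (+ (b +ℕ e +ℕ x) -ℤ + b) (+ (b +ℕ e) -ℤ + b) (+ b -ℤ + c) (+ (c +ℕ k) -ℤ + c)
                  (+ b -ℤ + (c +ℕ k))
      ≡⟨ offsetSummand-cong (m+n≡o⇒o-m≡n b (e +ℕ x) (≡.sym (ℕₚ.+-assoc b e x))) (m+n≡o⇒o-m≡n b e ≡.refl)
           (m+n≡o⇒o-m≡n c (k +ℕ t) ≡.refl) (m+n≡o⇒o-m≡n c k ≡.refl)
           (m+n≡o⇒o-m≡n (c +ℕ k) t (ℕₚ.+-assoc c k t)) ⟩
    offsetSummand (+ (e +ℕ x)) (+ e) (+ (k +ℕ t)) (+ k) (+ t)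
      ≈⟨ offsetSummand-factorises e x k t ⟩
    gauss (e +ℕ x) e * (gauss (k +ℕ t) k * gauss e t * qpow (t *ℕ t))
      ≡⟨ cong (gauss (e +ℕ x) e *_) (≡.sym (vandermondeTerm-diagonal k t e)) ⟩
    gauss (e +ℕ x) e * vandermondeTerm (k +ℕ t) e (k +ℕ t) k ∎
    where
      b : ℕ
      b = c +ℕ (k +ℕ t)

  sum-of-summands : ∀ a b c d {m e x} → c +ℕ m ≡ b → b +ℕ e ≡ d → d +ℕ x ≡ a →
    sumTo (summand (+ a) (+ b) (+ c) (+ d)) a
      ≈ gaussℤ (+ a -ℤ + b) (+ d -ℤ + b) * gaussℤ (+ d -ℤ + c) (+ b -ℤ + c)
  sum-of-summands _ _ c _ {m} {e} {x} ≡.refl ≡.refl ≡.refl = begin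
    sumTo f a
      ≡⟨ cong (sumTo f) (ℕₚ.+-assoc b e x) ⟩
    sumTo f (b +ℕ (e +ℕ x))
      ≈⟨ sumTo-dropTail f b (e +ℕ x) (λ _ → summand-vanishes-above (+ a) b (+ c) (+ d)) ⟩
    sumTo f b
      ≈⟨ sumTo-dropHead f c m (λ _ → summand-vanishes-below (+ a) (+ b) c (+ d)) ⟩
    sumTo (λ k → f (c +ℕ k)) m
      ≈⟨ sumTo-cong m (summand-at-c+k c m e x) ⟩
    sumTo (λ k → gauss (e +ℕ x) e * vandermondeTerm m e m k) m
      ≈⟨ sym (*-sumTo (gauss (e +ℕ x) e) (vandermondeTerm m e m) m) ⟩
    gauss (e +ℕ x) e * sumTo (vandermondeTerm m e m) m
      ≈⟨ *-congˡ (q-vandermonde m e m) ⟩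
    gauss (e +ℕ x) e * gauss (m +ℕ e) m
      ≡⟨ ≡.sym (cong₂ _*_
           (cong₂ gaussℤ (m+n≡o⇒o-m≡n b (e +ℕ x) (≡.sym (ℕₚ.+-assoc b e x))) (m+n≡o⇒o-m≡n b e ≡.refl))
           (cong₂ gaussℤ (m+n≡o⇒o-m≡n c (m +ℕ e) (≡.sym (ℕₚ.+-assoc c m e))) (m+n≡o⇒o-m≡n c m ≡.refl))) ⟩
    gaussℤ (+ a -ℤ + b) (+ d -ℤ + b) * gaussℤ (+ d -ℤ + c) (+ b -ℤ + c) ∎
    where
      a b d : ℕ
      b = c +ℕ m
      d = b +ℕ e
      a = d +ℕ x
      f : ℕ → Carrier
      f = summand (+ a) (+ b) (+ c) (+ d)

mainTheorem14 : {c ℓ : Level} (R : CommutativeRing c ℓ) (q : CommutativeRing.Carrier R)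
    (a b c' d : ℕ) → d ≤ a → b ≤ d → c' ≤ b →
    let open CommutativeRing R
        open Gauss R q
        A = + a
        B = + b
        C = + c'
        D = + d
    in sumTo (λ s → let S = + s in
                 gaussℤ (A -ℤ B) (B -ℤ S) * gaussℤ (B -ℤ C) (S -ℤ C)
                   * gaussℤ ((A -ℤ (B +ℤ B)) +ℤ S) ((D -ℤ (B +ℤ B)) +ℤ S)
                   * qpow (∣ B -ℤ S ∣ *ℕ ∣ B -ℤ S ∣)) a
       ≈ gaussℤ (A -ℤ B) (D -ℤ B) * gaussℤ (D -ℤ C) (B -ℤ C)
mainTheorem14 R q a b c' d d≤a b≤d c'≤b =
  GaussianIdentities.sum-of-summands R q a b c' d
    (proj₂ (m≤n⇒∃[o]m+o≡n c'≤b)) (proj₂ (m≤n⇒∃[o]m+o≡n b≤d)) (proj₂ (m≤n⇒∃[o]m+o≡n d≤a))
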